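{- Let $t\ge1$, $0\le k,s\le\lfloor t/2\rfloor$, and let $v$ be a $k$-vector. Let $(i_1,i_2,i_3,i_4)$ be a tuple of integers with $0\le i_j\le\min(k,s)$ and $i_1+i_2+i_3+i_4=2s+2k-t$. Then the number of $s$-vectors $w$ orthogonal to $v$ whose coincidence numbers with $v$ are exactly $(i_1,i_2,i_3,i_4)$ equals $$\prod_{j=1}^{4}\binom{k}{i_j}\binom{t-k}{s-i_j}.$$
   Context: Fix $t\ge1$. A $(0,1)$-vector of length $4t$ is divided into four quarters: positions $1..t$, $t+1..2t$, $2t+1..3t$, $3t+1..4t$. For $0\le k\le t$, a $k$-vector is a $(0,1)$-vector of length $4t$ with exactly $k$, $t-k$, $t-k$, $k$ ones in the four quarters respectively. Two $(0,1)$-vectors are orthogonal if their images under $0\mapsto1$, $1\mapsto-1$ are orthogonal. For a $k$-vector $v$ and an $s$-vector $w$, the coincidence numbers $(i_1,i_2,i_3,i_4)$ are: $i_1$ (resp. $i_4$) is the number of positions in the first (resp. fourth) quarter where both $v$ and $w$ equal $1$, and $i_2$ (resp. $i_3$) is the number of positions in the second (resp. third) quarter where both equal $0$. -}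

module Defs where

open import Data.Bool using (Bool; true; false)
open import Data.Nat using (ℕ; zero; suc; _+_; _*_; _∸_)
open import Data.Nat.Properties using (_≟_)
open import Data.Integer as ℤ using (ℤ; +_; -_)
open import Data.Integer.Properties as ℤP using ()
open import Data.Vec using (Vec; []; _∷_; take; drop; zipWith; foldr)
open import Data.List using (List; []; _∷_; map; _++_; filter; length)
open import Data.Product using (_×_; _,_)
open import Relation.Binary.PropositionalEquality using (_≡_)
open import Relation.Nullary using (Dec)
open import Relation.Nullary.Decidable using (_×-dec_)

-- (0,1)-vectors of length 4t: Bool encodes the entries (true = 1, false = 0);
-- the length t + (t + (t + t)) = 4t.
BVec : ℕ → Set
BVec t = Vec Bool (t + (t + (t + t)))

quarter1 quarter2 quarter3 quarter4 : ∀ t → BVec t → Vec Bool t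
quarter1 t v = take t v
quarter2 t v = take t (drop t v)
quarter3 t v = take t (drop t (drop t v))
quarter4 t v = drop t (drop t (drop t v))

ones : ∀ {n} → Vec Bool n → ℕ
ones [] = 0
ones (true ∷ xs) = suc (ones xs)
ones (false ∷ xs) = ones xs

both1 : ∀ {n} → Vec Bool n → Vec Bool n → ℕ
both1 [] [] = 0
both1 (true ∷ xs) (true ∷ ys) = suc (both1 xs ys)
both1 (_ ∷ xs) (_ ∷ ys) = both1 xs ys

both0 : ∀ {n} → Vec Bool n → Vec Bool n → ℕ
both0 [] [] = 0
both0 (false ∷ xs) (false ∷ ys) = suc (both0 xs ys)
both0 (_ ∷ xs) (_ ∷ ys) = both0 xs ys

IsKVector : ∀ t → ℕ → BVec t → Set
IsKVector t k v =
  (ones (quarter1 t v) ≡ k) × (ones (quarter2 t v) ≡ t ∸ k) ×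
  (ones (quarter3 t v) ≡ t ∸ k) × (ones (quarter4 t v) ≡ k)

isKVector? : ∀ t k (v : BVec t) → Dec (IsKVector t k v)
isKVector? t k v =
  (ones (quarter1 t v) ≟ k) ×-dec (ones (quarter2 t v) ≟ t ∸ k) ×-dec
  (ones (quarter3 t v) ≟ t ∸ k) ×-dec (ones (quarter4 t v) ≟ k)

sign : Bool → ℤ
sign false = + 1
sign true = - (+ 1)

dot : ∀ {n} → Vec Bool n → Vec Bool n → ℤ
dot v w = foldr _ ℤ._+_ (+ 0) (zipWith (λ a b → sign a ℤ.* sign b) v w)

Orthogonal : ∀ {n} → Vec Bool n → Vec Bool n → Set
Orthogonal v w = dot v w ≡ + 0

orthogonal? : ∀ {n} (v w : Vec Bool n) → Dec (Orthogonal v w)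
orthogonal? v w = dot v w ℤ.≟ + 0

HasCoincidences : ∀ t → BVec t → BVec t → ℕ → ℕ → ℕ → ℕ → Set
HasCoincidences t v w i1 i2 i3 i4 =
  (both1 (quarter1 t v) (quarter1 t w) ≡ i1) × (both0 (quarter2 t v) (quarter2 t w) ≡ i2) ×
  (both0 (quarter3 t v) (quarter3 t w) ≡ i3) × (both1 (quarter4 t v) (quarter4 t w) ≡ i4)

hasCoincidences? : ∀ t (v w : BVec t) i1 i2 i3 i4 → Dec (HasCoincidences t v w i1 i2 i3 i4)
hasCoincidences? t v w i1 i2 i3 i4 =
  (both1 (quarter1 t v) (quarter1 t w) ≟ i1) ×-dec (both0 (quarter2 t v) (quarter2 t w) ≟ i2) ×-dec
  (both0 (quarter3 t v) (quarter3 t w) ≟ i3) ×-dec (both1 (quarter4 t v) (quarter4 t w) ≟ i4)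

allVecs : ∀ n → List (Vec Bool n)
allVecs zero = [] ∷ []
allVecs (suc n) = map (false ∷_) (allVecs n) ++ map (true ∷_) (allVecs n)

countW : ∀ t (s : ℕ) (v : BVec t) (i1 i2 i3 i4 : ℕ) → ℕ
countW t s v i1 i2 i3 i4 =
  length (filter (λ w → isKVector? t s w ×-dec orthogonal? v w ×-dec hasCoincidences? t v w i1 i2 i3 i4)
                 (allVecs (t + (t + (t + t)))))

module Submission where

-- So the counted vectors are those whose quarters independently satisfy their own
-- conditions, and the count is the product of the four per-quarter counts.

open import Defs
import Data.Integer.Properties as ℤP
open import Algebra.Properties.AbelianGroup ℤP.+-0-abelianGroup using (identityˡ-unique)
open import Algebra.Properties.CommutativeSemigroup ℤP.+-commutativeSemigroup using (interchange)
open import Data.Bool using (Bool; true; false; _∧_; not; if_then_else_)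
open import Data.Bool.Properties using (∧-zeroʳ)
open import Data.Integer as ℤ using (ℤ; +_)
import Data.Integer.Tactic.RingSolver as ℤ-Solver
open import Data.List as List using (List; filter; length)
open import Data.List.Properties using (length-++; filter-++)
open import Data.Nat using (ℕ; zero; suc; _+_; _*_; _∸_; _≤_; _⊓_; s≤s)
open import Data.Nat.Combinatorics using (_C_; nCk+nC[k+1]≡[n+1]C[k+1])
open import Data.Nat.DivMod using (_/_; m/n≤m)
open import Data.Nat.Properties
import Data.Nat.Tactic.RingSolver as ℕ-Solver
open import Data.Product using (_×_; _,_)
open import Data.Vec using (Vec; []; _∷_; take; drop; map)
open import Function using (_∘_; _⇔_; mk⇔)
open import Relation.Binary.PropositionalEquality
open import Relation.Nullary using (Dec; does; yes; no; _×-dec_)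
open import Relation.Nullary.Decidable using (does-⇔; dec-false)
open import Relation.Unary using (Decidable)

open ≡-Reasoning

count : ∀ n → (Vec Bool n → Bool) → ℕ
count zero    f = if f [] then 1 else 0
count (suc n) f = count n (f ∘ (false ∷_)) + count n (f ∘ (true ∷_))

length-filter-map : ∀ {A B : Set} {P : B → Set} (P? : Decidable P) (g : A → B) (xs : List A) →
  length (filter P? (List.map g xs)) ≡ length (filter (P? ∘ g) xs)
length-filter-map P? g List.[] = refl
length-filter-map P? g (x List.∷ xs) with does (P? (g x))
... | true  = cong suc (length-filter-map P? g xs)
... | false = length-filter-map P? g xs

count-allVecs : ∀ n {P : Vec Bool n → Set} (P? : Decidable P) →
  length (filter P? (allVecs n)) ≡ count n (does ∘ P?)
count-allVecs zero P? with does (P? [])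
... | true  = refl
... | false = refl
count-allVecs (suc n) P? = begin
  length (filter P? (vs₀ List.++ vs₁))
    ≡⟨ cong length (filter-++ P? vs₀ vs₁) ⟩
  length (filter P? vs₀ List.++ filter P? vs₁)
    ≡⟨ length-++ (filter P? vs₀) ⟩
  length (filter P? vs₀) + length (filter P? vs₁)
    ≡⟨ cong₂ _+_ (trans (length-filter-map P? (false ∷_) (allVecs n)) (count-allVecs n _))
                 (trans (length-filter-map P? (true ∷_) (allVecs n)) (count-allVecs n _)) ⟩
  count (suc n) (does ∘ P?) ∎
  where
  vs₀ vs₁ : List (Vec Bool (suc n))
  vs₀ = List.map (false ∷_) (allVecs n)
  vs₁ = List.map (true ∷_) (allVecs n)

count-cong : ∀ n {f g : Vec Bool n → Bool} → (∀ u → f u ≡ g u) → count n f ≡ count n g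
count-cong zero    f≗g rewrite f≗g [] = refl
count-cong (suc n) f≗g =
  cong₂ _+_ (count-cong n (f≗g ∘ (false ∷_))) (count-cong n (f≗g ∘ (true ∷_)))

count-none : ∀ n {f : Vec Bool n → Bool} → (∀ u → f u ≡ false) → count n f ≡ 0
count-none zero    f≗false rewrite f≗false [] = refl
count-none (suc n) f≗false =
  cong₂ _+_ (count-none n (f≗false ∘ (false ∷_))) (count-none n (f≗false ∘ (true ∷_)))

count-product : ∀ m {n} (f : Vec Bool m → Bool) (g : Vec Bool n → Bool) →
  count (m + n) (λ w → f (take m w) ∧ g (drop m w)) ≡ count m f * count n g
count-product zero {n} f g with f []
... | true  = sym (+-identityʳ (count n g))
... | false = count-none n (λ _ → refl)
count-product (suc m) {n} f g = begin
  count (m + n) (λ w → f (false ∷ take m w) ∧ g (drop m w)) +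
  count (m + n) (λ w → f (true ∷ take m w) ∧ g (drop m w))
    ≡⟨ cong₂ _+_ (count-product m (f ∘ (false ∷_)) g) (count-product m (f ∘ (true ∷_)) g) ⟩
  count m (f ∘ (false ∷_)) * count n g + count m (f ∘ (true ∷_)) * count n g
    ≡⟨ sym (*-distribʳ-+ (count n g) (count m (f ∘ (false ∷_))) _) ⟩
  count (suc m) f * count n g ∎

count-quarters : ∀ t (f₁ f₂ f₃ f₄ : Vec Bool t → Bool) →
  count (t + (t + (t + t)))
    (λ w → f₁ (quarter1 t w) ∧ (f₂ (quarter2 t w) ∧ (f₃ (quarter3 t w) ∧ f₄ (quarter4 t w))))
  ≡ count t f₁ * (count t f₂ * (count t f₃ * count t f₄))
count-quarters t f₁ f₂ f₃ f₄ =
  trans (count-product t f₁ _)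
    (cong (count t f₁ *_) (trans (count-product t f₂ _)
      (cong (count t f₂ *_) (count-product t f₃ f₄))))

neg : ∀ {n} → Vec Bool n → Vec Bool n
neg = map not

-- Complementing is a bijection, so it does not change counts.
count-neg : ∀ n (f : Vec Bool n → Bool) → count n (f ∘ neg) ≡ count n f
count-neg zero    f = refl
count-neg (suc n) f =
  trans (cong₂ _+_ (count-neg n (f ∘ (true ∷_))) (count-neg n (f ∘ (false ∷_))))
        (+-comm (count n (f ∘ (true ∷_))) _)

zeros : ∀ {n} → Vec Bool n → ℕ
zeros []          = 0
zeros (true ∷ u)  = zeros u
zeros (false ∷ u) = suc (zeros u)

ones+zeros : ∀ {n} (u : Vec Bool n) → ones u + zeros u ≡ n
ones+zeros []          = refl
ones+zeros (true ∷ u)  = cong suc (ones+zeros u)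
ones+zeros (false ∷ u) = trans (+-suc (ones u) (zeros u)) (cong suc (ones+zeros u))

zeros-of : ∀ {n k} (u : Vec Bool n) → ones u ≡ k → zeros u ≡ n ∸ k
zeros-of u refl =
  trans (sym (m+n∸m≡n (ones u) (zeros u))) (cong (_∸ ones u) (ones+zeros u))

zeros-of-complement : ∀ {n k} (u : Vec Bool n) → k ≤ n → ones u ≡ n ∸ k → zeros u ≡ k
zeros-of-complement u k≤n eq = trans (zeros-of u eq) (m∸[m∸n]≡n k≤n)

ones-neg : ∀ {n} (u : Vec Bool n) → ones (neg u) ≡ zeros u
ones-neg []          = refl
ones-neg (true ∷ u)  = ones-neg u
ones-neg (false ∷ u) = cong suc (ones-neg u)

zeros-neg : ∀ {n} (u : Vec Bool n) → zeros (neg u) ≡ ones u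
zeros-neg []          = refl
zeros-neg (true ∷ u)  = cong suc (zeros-neg u)
zeros-neg (false ∷ u) = zeros-neg u

both0-neg : ∀ {n} (a u : Vec Bool n) → both0 a u ≡ both1 (neg a) (neg u)
both0-neg []          []          = refl
both0-neg (true ∷ a)  (true ∷ u)  = both0-neg a u
both0-neg (true ∷ a)  (false ∷ u) = both0-neg a u
both0-neg (false ∷ a) (true ∷ u)  = both0-neg a u
both0-neg (false ∷ a) (false ∷ u) = cong suc (both0-neg a u)

both1≤ones : ∀ {n} (a u : Vec Bool n) → both1 a u ≤ ones u
both1≤ones []          []          = ≤-refl
both1≤ones (true ∷ a)  (true ∷ u)  = s≤s (both1≤ones a u)
both1≤ones (false ∷ a) (true ∷ u)  = m≤n⇒m≤1+n (both1≤ones a u)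
both1≤ones (true ∷ a)  (false ∷ u) = both1≤ones a u
both1≤ones (false ∷ a) (false ∷ u) = both1≤ones a u

ones-complement : ∀ {n s} (u : Vec Bool n) → s ≤ n → (ones u ≡ n ∸ s) ⇔ (ones (neg u) ≡ s)
ones-complement u s≤n = mk⇔
  (λ eq → trans (ones-neg u) (zeros-of-complement u s≤n eq))
  (λ eq → trans (sym (zeros-neg u)) (zeros-of (neg u) eq))

Outer : ∀ {n} → ℕ → Vec Bool n → ℕ → Vec Bool n → Set
Outer b a i u = (ones u ≡ b) × (both1 a u ≡ i)

outer? : ∀ {n} b (a : Vec Bool n) i → Decidable (Outer b a i)
outer? b a i u = (ones u ≟ b) ×-dec (both1 a u ≟ i)

Inner : ∀ {n} → ℕ → Vec Bool n → ℕ → Vec Bool n → Set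
Inner b a i u = (ones u ≡ b) × (both0 a u ≡ i)

inner? : ∀ {n} b (a : Vec Bool n) i → Decidable (Inner b a i)
inner? b a i u = (ones u ≟ b) ×-dec (both0 a u ≟ i)

-- Since both1 a u ≤ ones u, no u has both suc (ones u) = i and both1 a u = i;
-- this kills the branch of choose-count where an extra one falls outside a's support.
no-extra-one : ∀ {x y} i → y ≤ x → does (suc x ≟ i) ∧ does (y ≟ i) ≡ false
no-extra-one {x} {y} i y≤x with y ≟ i
... | no y≢i    = trans (cong (does (suc x ≟ i) ∧_) (dec-false (y ≟ i) y≢i)) (∧-zeroʳ _)
... | yes refl =
  cong (_∧ does (y ≟ y)) (dec-false (suc x ≟ y) (λ 1+x≡y → 1+n≰n (subst (_≤ x) (sym 1+x≡y) y≤x)))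

choose-count : ∀ {n} (a : Vec Bool n) i j →
  count n (does ∘ outer? (i + j) a i) ≡ (ones a C i) * (zeros a C j)
choose-count []          zero    zero    = refl
choose-count []          zero    (suc j) = refl
choose-count []          (suc i) j       = refl
choose-count {suc n} (true ∷ a) zero j =
  trans (cong₂ _+_ (choose-count a zero j)
                   (count-none n (λ u → ∧-zeroʳ (does (suc (ones u) ≟ j)))))
        (+-identityʳ _)
choose-count (true ∷ a) (suc i) j = begin
  count _ (does ∘ outer? (suc i + j) a (suc i)) + count _ (does ∘ outer? (i + j) a i)
    ≡⟨ cong₂ _+_ (choose-count a (suc i) j) (choose-count a i j) ⟩
  (ones a C suc i) * (zeros a C j) + (ones a C i) * (zeros a C j)
    ≡⟨ sym (*-distribʳ-+ (zeros a C j) (ones a C suc i) _) ⟩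
  (ones a C suc i + ones a C i) * (zeros a C j)
    ≡⟨ cong (_* (zeros a C j)) (trans (+-comm (ones a C suc i) _) (nCk+nC[k+1]≡[n+1]C[k+1] (ones a) i)) ⟩
  (suc (ones a) C suc i) * (zeros a C j) ∎
choose-count {suc n} (false ∷ a) i zero =
  trans (cong₂ _+_ (choose-count a i zero) (count-none n no-u))
        (+-identityʳ _)
  where
  no-u : ∀ u → does (suc (ones u) ≟ i + 0) ∧ does (both1 a u ≟ i) ≡ false
  no-u u rewrite +-identityʳ i = no-extra-one i (both1≤ones a u)
choose-count {suc n} (false ∷ a) i (suc j) = begin
  count (suc n) (does ∘ outer? (i + suc j) (false ∷ a) i)
    ≡⟨ cong (_+_ (count n (does ∘ outer? (i + suc j) a i)))
            (count-cong n (λ u → cong (λ b → does (suc (ones u) ≟ b) ∧ does (both1 a u ≟ i))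
                                      (+-suc i j))) ⟩
  count n (does ∘ outer? (i + suc j) a i) + count n (does ∘ outer? (i + j) a i)
    ≡⟨ cong₂ _+_ (choose-count a i (suc j)) (choose-count a i j) ⟩
  (ones a C i) * (zeros a C suc j) + (ones a C i) * (zeros a C j)
    ≡⟨ sym (*-distribˡ-+ (ones a C i) (zeros a C suc j) _) ⟩
  (ones a C i) * (zeros a C suc j + zeros a C j)
    ≡⟨ cong ((ones a C i) *_) (trans (+-comm (zeros a C suc j) _) (nCk+nC[k+1]≡[n+1]C[k+1] (zeros a) j)) ⟩
  (ones a C i) * (suc (zeros a) C suc j) ∎

outer-quarter-count : ∀ {n k s i} (a : Vec Bool n) → ones a ≡ k → i ≤ s →
  count n (does ∘ outer? s a i) ≡ (k C i) * ((n ∸ k) C (s ∸ i))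
outer-quarter-count {n} {s = s} {i} a refl i≤s = begin
  count n (does ∘ outer? s a i)
    ≡⟨ cong (λ b → count n (does ∘ outer? b a i)) (sym (m+[n∸m]≡n i≤s)) ⟩
  count n (does ∘ outer? (i + (s ∸ i)) a i)
    ≡⟨ choose-count a i (s ∸ i) ⟩
  (ones a C i) * (zeros a C (s ∸ i))
    ≡⟨ cong (λ z → (ones a C i) * (z C (s ∸ i))) (zeros-of a refl) ⟩
  (ones a C i) * ((n ∸ ones a) C (s ∸ i)) ∎

-- Quarters 2 and 3: a has n ∸ k ones, u has n ∸ s ones, i common zeros.
-- Complementing u turns this into the outer count for the complement of a.
inner-quarter-count : ∀ {n k s i} (a : Vec Bool n) → ones a ≡ n ∸ k → k ≤ n → i ≤ s → s ≤ n →
  count n (does ∘ inner? (n ∸ s) a i) ≡ (k C i) * ((n ∸ k) C (s ∸ i))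
inner-quarter-count {n} {k} {s} {i} a oa k≤n i≤s s≤n = begin
  count n (does ∘ inner? (n ∸ s) a i)
    ≡⟨ count-cong n (λ u →
         cong₂ _∧_ (does-⇔ (ones-complement u s≤n) (ones u ≟ n ∸ s) (ones (neg u) ≟ s))
                   (cong (λ c → does (c ≟ i)) (both0-neg a u))) ⟩
  count n (does ∘ outer? s (neg a) i ∘ neg)
    ≡⟨ count-neg n (does ∘ outer? s (neg a) i) ⟩
  count n (does ∘ outer? s (neg a) i)
    ≡⟨ outer-quarter-count (neg a) (trans (ones-neg a) (zeros-of-complement a k≤n oa)) i≤s ⟩
  (k C i) * ((n ∸ k) C (s ∸ i)) ∎

dot-split : ∀ m {n} (v w : Vec Bool (m + n)) →
  dot v w ≡ dot (take m v) (take m w) ℤ.+ dot (drop m v) (drop m w)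
dot-split zero    v       w       = sym (ℤP.+-identityˡ (dot v w))
dot-split (suc m) (x ∷ v) (y ∷ w) =
  trans (cong (ℤ._+_ (sign x ℤ.* sign y)) (dot-split m v w))
        (sym (ℤP.+-assoc (sign x ℤ.* sign y) _ _))

dot-quarters : ∀ t (v w : BVec t) →
  dot v w ≡ dot (quarter1 t v) (quarter1 t w) ℤ.+ (dot (quarter2 t v) (quarter2 t w) ℤ.+
            (dot (quarter3 t v) (quarter3 t w) ℤ.+ dot (quarter4 t v) (quarter4 t w)))
dot-quarters t v w =
  trans (dot-split t v w) (cong (ℤ._+_ (dot (quarter1 t v) (quarter1 t w)))
    (trans (dot-split t (drop t v) (drop t w))
      (cong (ℤ._+_ (dot (quarter2 t v) (quarter2 t w)))
        (dot-split t (drop t (drop t v)) (drop t (drop t w))))))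

-- One coordinate of the recursion for dot-ones: a position contributing c to
-- the inner product and e resp. f to the two natural-number sides.
dot-step : ∀ (c d : ℤ) {X Y e f X′ Y′ : ℕ} → c ℤ.+ + e ≡ + f → X′ ≡ e + X → Y′ ≡ f + Y →
  d ℤ.+ + X ≡ + Y → (c ℤ.+ d) ℤ.+ + X′ ≡ + Y′
dot-step c d {X} {Y} {e} {f} cef refl refl dXY = begin
  (c ℤ.+ d) ℤ.+ + (e + X)      ≡⟨ cong (ℤ._+_ (c ℤ.+ d)) (ℤP.pos-+ e X) ⟩
  (c ℤ.+ d) ℤ.+ (+ e ℤ.+ + X)  ≡⟨ interchange c d (+ e) (+ X) ⟩
  (c ℤ.+ + e) ℤ.+ (d ℤ.+ + X)  ≡⟨ cong₂ ℤ._+_ cef dXY ⟩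
  + f ℤ.+ + Y                  ≡⟨ sym (ℤP.pos-+ f Y) ⟩
  + (f + Y)                    ∎

-- dot a u = n − 2(|u| + |a|) + 4·both1 a u, stated without subtraction.
dot-ones : ∀ {n} (a u : Vec Bool n) →
  dot a u ℤ.+ + (2 * ones u + 2 * ones a) ≡ + (4 * both1 a u + n)
dot-ones []          []          = refl
dot-ones {suc n} (true ∷ a) (true ∷ u) =
  dot-step (sign true ℤ.* sign true) (dot a u) {e = 4} {f = 5} refl
           (two-ones (ones u) (ones a)) (common-one (both1 a u) n) (dot-ones a u)
  where
  two-ones : ∀ x y → 2 * suc x + 2 * suc y ≡ 4 + (2 * x + 2 * y)
  two-ones = ℕ-Solver.solve-∀
  common-one : ∀ b m → 4 * suc b + suc m ≡ 5 + (4 * b + m)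
  common-one = ℕ-Solver.solve-∀
dot-ones {suc n} (true ∷ a) (false ∷ u) =
  dot-step (sign true ℤ.* sign false) (dot a u) {e = 2} {f = 1} refl
           (one-of-a (ones u) (ones a)) (+-suc _ n) (dot-ones a u)
  where
  one-of-a : ∀ x y → 2 * x + 2 * suc y ≡ 2 + (2 * x + 2 * y)
  one-of-a = ℕ-Solver.solve-∀
dot-ones {suc n} (false ∷ a) (true ∷ u) =
  dot-step (sign false ℤ.* sign true) (dot a u) {e = 2} {f = 1} refl
           (one-of-u (ones u) (ones a)) (+-suc _ n) (dot-ones a u)
  where
  one-of-u : ∀ x y → 2 * suc x + 2 * y ≡ 2 + (2 * x + 2 * y)
  one-of-u = ℕ-Solver.solve-∀
dot-ones {suc n} (false ∷ a) (false ∷ u) =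
  dot-step (sign false ℤ.* sign false) (dot a u) {e = 0} {f = 1} refl
           refl (+-suc _ n) (dot-ones a u)

dot-neg : ∀ {n} (a u : Vec Bool n) → dot (neg a) (neg u) ≡ dot a u
dot-neg []          []          = refl
dot-neg (x ∷ a) (y ∷ u) = cong₂ ℤ._+_ (sign-not x y) (dot-neg a u)
  where
  sign-not : ∀ x y → sign (not x) ℤ.* sign (not y) ≡ sign x ℤ.* sign y
  sign-not true  true  = refl
  sign-not true  false = refl
  sign-not false true  = refl
  sign-not false false = refl

dot-zeros : ∀ {n} (a u : Vec Bool n) →
  dot a u ℤ.+ + (2 * zeros u + 2 * zeros a) ≡ + (4 * both0 a u + n)
dot-zeros {n} a u = begin
  dot a u ℤ.+ + (2 * zeros u + 2 * zeros a)
    ≡⟨ sym (cong₂ (λ d m → d ℤ.+ + m) (dot-neg a u)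
                  (cong₂ (λ x y → 2 * x + 2 * y) (ones-neg u) (ones-neg a))) ⟩
  dot (neg a) (neg u) ℤ.+ + (2 * ones (neg u) + 2 * ones (neg a))
    ≡⟨ dot-ones (neg a) (neg u) ⟩
  + (4 * both1 (neg a) (neg u) + n)
    ≡⟨ cong (λ b → + (4 * b + n)) (sym (both0-neg a u)) ⟩
  + (4 * both0 a u + n) ∎

outer-quarter-dot : ∀ {n k s i} (a u : Vec Bool n) → ones a ≡ k → ones u ≡ s → both1 a u ≡ i →
  dot a u ℤ.+ + (2 * s + 2 * k) ≡ + (4 * i + n)
outer-quarter-dot a u refl refl refl = dot-ones a u

inner-quarter-dot : ∀ {n k s i} (a u : Vec Bool n) → k ≤ n → s ≤ n →
  ones a ≡ n ∸ k → ones u ≡ n ∸ s → both0 a u ≡ i →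
  dot a u ℤ.+ + (2 * s + 2 * k) ≡ + (4 * i + n)
inner-quarter-dot a u k≤n s≤n oa ou refl =
  subst₂ (λ x y → dot a u ℤ.+ + (2 * y + 2 * x) ≡ _)
         (zeros-of-complement a k≤n oa) (zeros-of-complement u s≤n ou) (dot-zeros a u)

four-terms-cancel : ∀ (d₁ d₂ d₃ d₄ : ℤ) (c : ℕ) {e₁ e₂ e₃ e₄ : ℕ} →
  d₁ ℤ.+ + c ≡ + e₁ → d₂ ℤ.+ + c ≡ + e₂ → d₃ ℤ.+ + c ≡ + e₃ → d₄ ℤ.+ + c ≡ + e₄ →
  e₁ + (e₂ + (e₃ + e₄)) ≡ c + (c + (c + c)) →
  d₁ ℤ.+ (d₂ ℤ.+ (d₃ ℤ.+ d₄)) ≡ + 0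
four-terms-cancel d₁ d₂ d₃ d₄ c {e₁} {e₂} {e₃} {e₄} h₁ h₂ h₃ h₄ sum =
  identityˡ-unique _ (+ (c + (c + (c + c)))) (begin
    (d₁ ℤ.+ (d₂ ℤ.+ (d₃ ℤ.+ d₄))) ℤ.+ + (c + (c + (c + c)))
      ≡⟨ cong (ℤ._+_ (d₁ ℤ.+ (d₂ ℤ.+ (d₃ ℤ.+ d₄)))) (pos-sum₄ c c c c) ⟩
    (d₁ ℤ.+ (d₂ ℤ.+ (d₃ ℤ.+ d₄))) ℤ.+ (+ c ℤ.+ (+ c ℤ.+ (+ c ℤ.+ + c)))
      ≡⟨ regroup d₁ d₂ d₃ d₄ (+ c) ⟩
    (d₁ ℤ.+ + c) ℤ.+ ((d₂ ℤ.+ + c) ℤ.+ ((d₃ ℤ.+ + c) ℤ.+ (d₄ ℤ.+ + c)))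
      ≡⟨ cong₂ ℤ._+_ h₁ (cong₂ ℤ._+_ h₂ (cong₂ ℤ._+_ h₃ h₄)) ⟩
    + e₁ ℤ.+ (+ e₂ ℤ.+ (+ e₃ ℤ.+ + e₄))
      ≡⟨ sym (pos-sum₄ e₁ e₂ e₃ e₄) ⟩
    + (e₁ + (e₂ + (e₃ + e₄)))
      ≡⟨ cong +_ sum ⟩
    + (c + (c + (c + c))) ∎)
  where
  regroup : ∀ a b x y z → (a ℤ.+ (b ℤ.+ (x ℤ.+ y))) ℤ.+ (z ℤ.+ (z ℤ.+ (z ℤ.+ z)))
                        ≡ (a ℤ.+ z) ℤ.+ ((b ℤ.+ z) ℤ.+ ((x ℤ.+ z) ℤ.+ (y ℤ.+ z)))
  regroup = ℤ-Solver.solve-∀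
  pos-sum₄ : ∀ a b x y → + (a + (b + (x + y))) ≡ + a ℤ.+ (+ b ℤ.+ (+ x ℤ.+ + y))
  pos-sum₄ a b x y =
    trans (ℤP.pos-+ a _) (cong (ℤ._+_ (+ a)) (trans (ℤP.pos-+ b _) (cong (ℤ._+_ (+ b)) (ℤP.pos-+ x y))))

coincidence-sum : ∀ t k s i₁ i₂ i₃ i₄ → i₁ + i₂ + i₃ + i₄ + t ≡ 2 * s + 2 * k →
  (4 * i₁ + t) + ((4 * i₂ + t) + ((4 * i₃ + t) + (4 * i₄ + t)))
  ≡ (2 * s + 2 * k) + ((2 * s + 2 * k) + ((2 * s + 2 * k) + (2 * s + 2 * k)))
coincidence-sum t k s i₁ i₂ i₃ i₄ hsum =
  trans (spread i₁ i₂ i₃ i₄ t) (cong (λ x → x + (x + (x + x))) hsum)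
  where
  spread : ∀ a b c d e → (4 * a + e) + ((4 * b + e) + ((4 * c + e) + (4 * d + e)))
         ≡ (a + b + c + d + e) + ((a + b + c + d + e) + ((a + b + c + d + e) + (a + b + c + d + e)))
  spread = ℕ-Solver.solve-∀

orthogonal-by-coincidences : ∀ t {k s i₁ i₂ i₃ i₄} {v w : BVec t} → k ≤ t → s ≤ t →
  IsKVector t k v → IsKVector t s w → HasCoincidences t v w i₁ i₂ i₃ i₄ →
  i₁ + i₂ + i₃ + i₄ + t ≡ 2 * s + 2 * k → Orthogonal v w
orthogonal-by-coincidences t {k} {s} {i₁} {i₂} {i₃} {i₄} {v} {w} k≤t s≤t
                           (v₁ , v₂ , v₃ , v₄) (w₁ , w₂ , w₃ , w₄) (c₁ , c₂ , c₃ , c₄) hsum =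
  trans (dot-quarters t v w)
    (four-terms-cancel (dq quarter1) (dq quarter2) (dq quarter3) (dq quarter4) (2 * s + 2 * k)
      (outer-quarter-dot (quarter1 t v) (quarter1 t w) v₁ w₁ c₁)
      (inner-quarter-dot (quarter2 t v) (quarter2 t w) k≤t s≤t v₂ w₂ c₂)
      (inner-quarter-dot (quarter3 t v) (quarter3 t w) k≤t s≤t v₃ w₃ c₃)
      (outer-quarter-dot (quarter4 t v) (quarter4 t w) v₄ w₄ c₄)
      (coincidence-sum t k s i₁ i₂ i₃ i₄ hsum))
  where
  dq : (∀ t → BVec t → Vec Bool t) → ℤ
  dq quarter = dot (quarter t v) (quarter t w)

QuarterConditions : ∀ t → ℕ → BVec t → ℕ → ℕ → ℕ → ℕ → BVec t → Set
QuarterConditions t s v i₁ i₂ i₃ i₄ w =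
  Outer s (quarter1 t v) i₁ (quarter1 t w) × (Inner (t ∸ s) (quarter2 t v) i₂ (quarter2 t w) ×
  (Inner (t ∸ s) (quarter3 t v) i₃ (quarter3 t w) × Outer s (quarter4 t v) i₄ (quarter4 t w)))

quarterConditions? : ∀ t s (v : BVec t) i₁ i₂ i₃ i₄ → Decidable (QuarterConditions t s v i₁ i₂ i₃ i₄)
quarterConditions? t s v i₁ i₂ i₃ i₄ w =
  outer? s (quarter1 t v) i₁ (quarter1 t w) ×-dec (inner? (t ∸ s) (quarter2 t v) i₂ (quarter2 t w) ×-dec
  (inner? (t ∸ s) (quarter3 t v) i₃ (quarter3 t w) ×-dec outer? s (quarter4 t v) i₄ (quarter4 t w)))

counted⇔quarterConditions : ∀ t {k s i₁ i₂ i₃ i₄} {v : BVec t} → k ≤ t → s ≤ t →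
  IsKVector t k v → i₁ + i₂ + i₃ + i₄ + t ≡ 2 * s + 2 * k → (w : BVec t) →
  (IsKVector t s w × Orthogonal v w × HasCoincidences t v w i₁ i₂ i₃ i₄)
  ⇔ QuarterConditions t s v i₁ i₂ i₃ i₄ w
counted⇔quarterConditions t k≤t s≤t kv hsum w = mk⇔
  (λ { ((o₁ , o₂ , o₃ , o₄) , _ , (c₁ , c₂ , c₃ , c₄)) →
       (o₁ , c₁) , (o₂ , c₂) , (o₃ , c₃) , (o₄ , c₄) })
  (λ { ((o₁ , c₁) , (o₂ , c₂) , (o₃ , c₃) , (o₄ , c₄)) →
       let sw = (o₁ , o₂ , o₃ , o₄); cs = (c₁ , c₂ , c₃ , c₄) in
       sw , orthogonal-by-coincidences t k≤t s≤t kv sw cs hsum , cs })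

lemma6 : (t k s : ℕ) → 1 ≤ t → k ≤ t / 2 → s ≤ t / 2 →
    (v : BVec t) → IsKVector t k v →
    (i1 i2 i3 i4 : ℕ) →
    i1 ≤ k ⊓ s → i2 ≤ k ⊓ s → i3 ≤ k ⊓ s → i4 ≤ k ⊓ s →
    i1 + i2 + i3 + i4 + t ≡ 2 * s + 2 * k →
    countW t s v i1 i2 i3 i4 ≡
      ((k C i1) * ((t ∸ k) C (s ∸ i1))) * ((k C i2) * ((t ∸ k) C (s ∸ i2))) *
      ((k C i3) * ((t ∸ k) C (s ∸ i3))) * ((k C i4) * ((t ∸ k) C (s ∸ i4)))
lemma6 t k s _ k≤t/2 s≤t/2 v kv@(v₁ , v₂ , v₃ , v₄) i1 i2 i3 i4 h1 h2 h3 h4 hsum = begin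
  countW t s v i1 i2 i3 i4
    ≡⟨ count-allVecs (t + (t + (t + t))) counted? ⟩
  count (t + (t + (t + t))) (does ∘ counted?)
    ≡⟨ count-cong _ (λ w → does-⇔ (counted⇔quarterConditions t k≤t s≤t kv hsum w)
                                  (counted? w) (quarterConditions? t s v i1 i2 i3 i4 w)) ⟩
  count (t + (t + (t + t))) (does ∘ quarterConditions? t s v i1 i2 i3 i4)
    ≡⟨ count-quarters t f₁ f₂ f₃ f₄ ⟩
  count t f₁ * (count t f₂ * (count t f₃ * count t f₄))
    ≡⟨ cong₂ _*_ (outer-quarter-count (quarter1 t v) v₁ (i≤s h1))
         (cong₂ _*_ (inner-quarter-count (quarter2 t v) v₂ k≤t (i≤s h2) s≤t)
           (cong₂ _*_ (inner-quarter-count (quarter3 t v) v₃ k≤t (i≤s h3) s≤t)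
                      (outer-quarter-count (quarter4 t v) v₄ (i≤s h4)))) ⟩
  B₁ * (B₂ * (B₃ * B₄))
    ≡⟨ sym (trans (*-assoc (B₁ * B₂) B₃ B₄) (*-assoc B₁ B₂ (B₃ * B₄))) ⟩
  B₁ * B₂ * B₃ * B₄ ∎
  where
  k≤t : k ≤ t
  k≤t = ≤-trans k≤t/2 (m/n≤m t 2)
  s≤t : s ≤ t
  s≤t = ≤-trans s≤t/2 (m/n≤m t 2)
  i≤s : ∀ {i} → i ≤ k ⊓ s → i ≤ s
  i≤s = m≤n⊓o⇒m≤o k s
  counted? : (w : BVec t) →
    Dec (IsKVector t s w × Orthogonal v w × HasCoincidences t v w i1 i2 i3 i4)
  counted? w = isKVector? t s w ×-dec orthogonal? v w ×-dec hasCoincidences? t v w i1 i2 i3 i4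
  f₁ f₂ f₃ f₄ : Vec Bool t → Bool
  f₁ = does ∘ outer? s (quarter1 t v) i1
  f₂ = does ∘ inner? (t ∸ s) (quarter2 t v) i2
  f₃ = does ∘ inner? (t ∸ s) (quarter3 t v) i3
  f₄ = does ∘ outer? s (quarter4 t v) i4
  B : ℕ → ℕ
  B i = (k C i) * ((t ∸ k) C (s ∸ i))
  B₁ B₂ B₃ B₄ : ℕ
  B₁ = B i1
  B₂ = B i2
  B₃ = B i3
  B₄ = B i4
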